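{- Let $(E,f)$ be a polymatroid and let $L_0,L_1,L_2\subseteq E$ satisfy $f(L_i)=2$ for $i=0,1,2$, $f(L_i\cup L_j)=3$ for $i\neq j$, and $f(L_0\cup L_1\cup L_2)=4$. Let $(E\cup\{z\},g)$, with $z\notin E$, be an Ahlswede–Körner extension of $(E,f)$ for the pair $(L_1\cup L_2,\,L_0)$. Then $g(z\mid L_i)=0$ for each $i=0,1,2$.
   Context: A polymatroid is a pair $(E,f)$ with $E$ a finite set and $f:\mathcal P(E)\to\mathbb R$ monotone, submodular, with $f(\emptyset)=0$. Notation: for $X,Y,Z\subseteq E$, $f(X\mid Z)=f(X\cup Z)-f(Z)$ and $f(X:Y\mid Z)=f(X\cup Z)+f(Y\cup Z)-f(X\cup Y\cup Z)-f(Z)$; singletons are written without braces. A polymatroid $(E\cup Z,g)$ with $E\cap Z=\emptyset$ is an extension of $(E,f)$ if $g(X)=f(X)$ for all $X\subseteq E$. For $X,Y\subseteq E$, an extension $(E\cup Z,g)$ is an Ahlswede–Körner (AK) extension for the pair $(X,Y)$ if $g(Z\mid X)=0$ and $g(X'\mid Z)=g(X'\mid Y)$ for every $X'\subseteq X$. -}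

module Defs where

open import Level using (Level; _⊔_; suc)
open import Data.Nat using (ℕ)
import Data.Nat as ℕ
open import Data.Product using (Σ; _×_)
open import Data.Vec using (_∷_)
open import Data.Fin.Subset using (Subset; _∪_; _∩_; _⊆_; ⊥; inside; outside)
open import Relation.Binary.Structures using (IsTotalOrder)
open import Relation.Nullary using (¬_)
open import Algebra.Structures using (IsCommutativeRing)

-- Ordered fields (the stdlib has no reals; we work over an arbitrary
-- ordered field, of which ℝ is an instance).

record OrderedField (c ℓ₁ ℓ₂ : Level) : Set (suc (c ⊔ ℓ₁ ⊔ ℓ₂)) where
  infix  4 _≈_ _≤_
  infixl 6 _+_ _-_
  infixl 7 _*_
  field
    Carrier : Set c
    _≈_     : Carrier → Carrier → Set ℓ₁
    _≤_     : Carrier → Carrier → Set ℓ₂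
    _+_     : Carrier → Carrier → Carrier
    _*_     : Carrier → Carrier → Carrier
    -_      : Carrier → Carrier
    0#      : Carrier
    1#      : Carrier
    isCommutativeRing : IsCommutativeRing _≈_ _+_ _*_ -_ 0# 1#
    isTotalOrder      : IsTotalOrder _≈_ _≤_
    0≉1     : ¬ (0# ≈ 1#)
    inverse : ∀ x → ¬ (x ≈ 0#) → Σ Carrier (λ y → (x * y) ≈ 1#)
    +-monoˡ-≤ : ∀ {x y} z → x ≤ y → x + z ≤ y + z
    *-nonneg  : ∀ {x y} → 0# ≤ x → 0# ≤ y → 0# ≤ x * y

  _-_ : Carrier → Carrier → Carrier
  x - y = x + (- y)

  2# 3# 4# : Carrier
  2# = 1# + 1#
  3# = 2# + 1#
  4# = 3# + 1#

module _ {c ℓ₁ ℓ₂} (F : OrderedField c ℓ₁ ℓ₂) where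
  open OrderedField F

  record IsPolymatroid (n : ℕ) (f : Subset n → Carrier) : Set (c ⊔ ℓ₁ ⊔ ℓ₂) where
    field
      normalized  : f ⊥ ≈ 0#
      monotone    : ∀ {X Y} → X ⊆ Y → f X ≤ f Y
      submodular  : ∀ X Y → f (X ∪ Y) + f (X ∩ Y) ≤ f X + f Y

  cond : ∀ {n} → (Subset n → Carrier) → Subset n → Subset n → Carrier
  cond f X Z = f (X ∪ Z) - f Z

  -- One-point extensions: the ground set E ∪ {z} is Fin (suc n), where
  -- z is the new element  zero  and e ∈ E = Fin n is identified with  suc e.
  -- A subset X ⊆ E is embedded as  outside ∷ X ; the set {z} is  inside ∷ ⊥.
  lift : ∀ {n} → Subset n → Subset (ℕ.suc n)
  lift X = outside ∷ X

  Zset : ∀ {n} → Subset (ℕ.suc n)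
  Zset = inside ∷ ⊥

  record IsOnePointExtension (n : ℕ) (f : Subset n → Carrier)
           (g : Subset (ℕ.suc n) → Carrier) : Set (c ⊔ ℓ₁ ⊔ ℓ₂) where
    field
      polymatroid : IsPolymatroid (ℕ.suc n) g
      restricts   : ∀ X → g (lift X) ≈ f X

  record IsAKExtension (n : ℕ) (f : Subset n → Carrier)
           (g : Subset (ℕ.suc n) → Carrier) (X Y : Subset n) : Set (c ⊔ ℓ₁ ⊔ ℓ₂) where
    field
      extension : IsOnePointExtension n f g
      determined : cond g Zset (lift X) ≈ 0#
      same-info  : ∀ X' → X' ⊆ X → cond g (lift X') Zset ≈ cond g (lift X') (lift Y)

-- Write Z = {z} and L = L₁ ∪ L₂. As g(· | Z) = g(· | L₀) on subsets of L,
-- g(Z | Lᵢ) = g(Z | L) + I(L : L₀) − I(Lᵢ : L₀), and both mutual informations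
-- equal 1 while g(Z | L) = 0; so Z is determined by L₁ and by L₂, hence by
-- L₀ ∪ L₁ and L₀ ∪ L₂. Because f(L₀ ∪ L₁) + f(L₀ ∪ L₂) = f(L₀ ∪ L₁ ∪ L₂) + f(L₀),
-- submodularity of g then forces g(Z | L₀) = 0 as well.
module Submission where

open import Defs
open import Data.Nat using (ℕ; suc)
open import Data.Fin.Subset using (Subset; _∪_; _∩_; _⊆_)
open import Data.Fin.Subset.Properties
  using (p⊆p∪q; q⊆p∪q; ⊆-trans; x∈p∩q⁺; x∈p∪q⁻; ∪-comm; ∪-idempotentCommutativeMonoid)
open import Level using (Level)
open import Data.Product using (_×_; _,_)
open import Data.Sum using ([_,_]′)
open import Algebra.Bundles using (CommutativeRing)
open import Relation.Binary.Bundles using (Poset)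
open import Relation.Binary.Structures using (IsTotalOrder)
open import Relation.Binary.PropositionalEquality using (cong; sym)
import Algebra.Properties.Group as GroupProperties
import Algebra.Properties.CommutativeSemigroup as CommutativeSemigroupProperties
import Algebra.Properties.IdempotentCommutativeMonoid as IdempotentCommutativeMonoidProperties
import Relation.Binary.Reasoning.Setoid as SetoidReasoning
import Relation.Binary.Reasoning.PartialOrder as PosetReasoning

∪-least : ∀ {n} {A B C : Subset n} → A ⊆ C → B ⊆ C → A ∪ B ⊆ C
∪-least {A = A} {B} A⊆C B⊆C x∈A∪B = [ A⊆C , B⊆C ]′ (x∈p∪q⁻ A B x∈A∪B)

∩-greatest : ∀ {n} {A B C : Subset n} → A ⊆ B → A ⊆ C → A ⊆ B ∩ C
∩-greatest A⊆B A⊆C x∈A = x∈p∩q⁺ (A⊆B x∈A , A⊆C x∈A)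

module OrderedFieldProperties {c ℓ₁ ℓ₂} (F : OrderedField c ℓ₁ ℓ₂) where

  open OrderedField F

  ring : CommutativeRing c ℓ₁
  ring = record { isCommutativeRing = isCommutativeRing }

  open CommutativeRing ring public
    using (+-assoc; +-comm; +-cong; +-congˡ; +-congʳ; setoid; +-group; +-commutativeSemigroup)
    renaming (sym to ≈-sym; trans to ≈-trans; reflexive to ≈-reflexive)

  poset : Poset c ℓ₁ ℓ₂
  poset = record { isPartialOrder = IsTotalOrder.isPartialOrder isTotalOrder }

  open Poset poset public using (antisym; reflexive) renaming (trans to ≤-trans)

  open GroupProperties +-group public
    using (x∙y⁻¹≈ε⇒x≈y; x≈y⇒x∙y⁻¹≈ε; //-rightDividesˡ; //-rightDividesʳ)
    renaming (∙-cancelʳ to +-cancelʳ)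

  x-y≈0⇒x≈y : ∀ {x y} → x - y ≈ 0# → x ≈ y
  x-y≈0⇒x≈y = x∙y⁻¹≈ε⇒x≈y _ _

  x≈y⇒x-y≈0 : ∀ {x y} → x ≈ y → x - y ≈ 0#
  x≈y⇒x-y≈0 = x≈y⇒x∙y⁻¹≈ε

  open CommutativeSemigroupProperties +-commutativeSemigroup public
    using (xy∙z≈x∙zy; xy∙z≈xz∙y; x∙yz≈yx∙z)

  -≈-⇒+≈+ : ∀ {a b c d} → a - b ≈ c - d → a + d ≈ c + b
  -≈-⇒+≈+ {a} {b} {c} {d} a-b≈c-d = begin
    a + d          ≈⟨ +-congʳ (//-rightDividesˡ b a) ⟨
    a - b + b + d  ≈⟨ +-congʳ (+-congʳ a-b≈c-d) ⟩
    c - d + b + d  ≈⟨ xy∙z≈xz∙y (c - d) b d ⟩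
    c - d + d + b  ≈⟨ +-congʳ (//-rightDividesˡ d c) ⟩
    c + b          ∎
    where open SetoidReasoning setoid

  +-mono-≤ : ∀ {x y u v} → x ≤ y → u ≤ v → x + u ≤ y + v
  +-mono-≤ {x} {y} {u} {v} x≤y u≤v = begin
    x + u  ≤⟨ +-monoˡ-≤ u x≤y ⟩
    y + u  ≈⟨ +-comm y u ⟩
    u + y  ≤⟨ +-monoˡ-≤ y u≤v ⟩
    v + y  ≈⟨ +-comm v y ⟩
    y + v  ∎
    where open PosetReasoning poset

  +-cancelʳ-≤ : ∀ {x y} a → x + a ≤ y + a → x ≤ y
  +-cancelʳ-≤ {x} {y} a x+a≤y+a = begin
    x          ≈⟨ //-rightDividesʳ a x ⟨
    x + a - a  ≤⟨ +-monoˡ-≤ (- a) x+a≤y+a ⟩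
    y + a - a  ≈⟨ //-rightDividesʳ a y ⟩
    y          ∎
    where open PosetReasoning poset

  +-cancelˡ-≤ : ∀ {x y} a → a + x ≤ a + y → x ≤ y
  +-cancelˡ-≤ {x} {y} a a+x≤a+y =
    +-cancelʳ-≤ a (≤-trans (reflexive (+-comm x a)) (≤-trans a+x≤a+y (reflexive (+-comm a y))))

  +≈+-cong : ∀ {x y u v a b c d} → x ≈ a → y ≈ b → u ≈ c → v ≈ d →
             a + b ≈ c + d → x + y ≈ u + v
  +≈+-cong x≈a y≈b u≈c v≈d a+b≈c+d =
    ≈-trans (+-cong x≈a y≈b) (≈-trans a+b≈c+d (≈-sym (+-cong u≈c v≈d)))

  3+3≈2+4 : 3# + 3# ≈ 2# + 4#
  3+3≈2+4 = ≈-trans (+-assoc 2# 1# 3#) (+-congˡ (+-comm 1# 3#))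

module PolymatroidProperties {c ℓ₁ ℓ₂} (F : OrderedField c ℓ₁ ℓ₂)
  {m : ℕ} {g : Subset m → OrderedField.Carrier F} (isPolymatroid : IsPolymatroid F m g) where

  open OrderedField F
  open OrderedFieldProperties F
  open IsPolymatroid isPolymatroid

  submodular-⊆ : ∀ {P Q A B} → P ⊆ A ∪ B → Q ⊆ A ∩ B → g P + g Q ≤ g A + g B
  submodular-⊆ {A = A} {B} P⊆A∪B Q⊆A∩B =
    ≤-trans (+-mono-≤ (monotone P⊆A∪B) (monotone Q⊆A∩B)) (submodular A B)

  rank≤⇒cond≈0 : ∀ {Z X} → g (Z ∪ X) ≤ g X → cond F g Z X ≈ 0#
  rank≤⇒cond≈0 {Z} {X} Z∪X≤X = x≈y⇒x-y≈0 (antisym Z∪X≤X (monotone (q⊆p∪q Z X)))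

  cond≈0⇒rank≈ : ∀ {Z X} → cond F g Z X ≈ 0# → g (Z ∪ X) ≈ g X
  cond≈0⇒rank≈ = x-y≈0⇒x≈y

  cond≈0-mono : ∀ {Z X Y} → X ⊆ Y → cond F g Z X ≈ 0# → cond F g Z Y ≈ 0#
  cond≈0-mono {Z} {X} {Y} X⊆Y Z|X≈0 = rank≤⇒cond≈0 (+-cancelʳ-≤ (g X) (begin
    g (Z ∪ Y) + g X  ≤⟨ submodular-⊆ Z∪Y⊆Z∪X∪Y X⊆Z∪X∩Y ⟩
    g (Z ∪ X) + g Y  ≈⟨ +-congʳ (cond≈0⇒rank≈ Z|X≈0) ⟩
    g X + g Y        ≈⟨ +-comm (g X) (g Y) ⟩
    g Y + g X        ∎))
    where
    open PosetReasoning poset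
    Z∪Y⊆Z∪X∪Y : Z ∪ Y ⊆ (Z ∪ X) ∪ Y
    Z∪Y⊆Z∪X∪Y = ∪-least (⊆-trans (p⊆p∪q X) (p⊆p∪q Y)) (q⊆p∪q (Z ∪ X) Y)
    X⊆Z∪X∩Y : X ⊆ (Z ∪ X) ∩ Y
    X⊆Z∪X∩Y = ∩-greatest (q⊆p∪q Z X) X⊆Y

  cond≈0-meet : ∀ {Z X Y W} → W ⊆ X → W ⊆ Y → g X + g Y ≈ g (X ∪ Y) + g W →
                cond F g Z X ≈ 0# → cond F g Z Y ≈ 0# → cond F g Z W ≈ 0#
  cond≈0-meet {Z} {X} {Y} {W} W⊆X W⊆Y modular Z|X≈0 Z|Y≈0 =
    rank≤⇒cond≈0 (+-cancelˡ-≤ (g (X ∪ Y)) (begin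
      g (X ∪ Y) + g (Z ∪ W)  ≤⟨ submodular-⊆ X∪Y⊆Z∪X∪Z∪Y Z∪W⊆Z∪X∩Z∪Y ⟩
      g (Z ∪ X) + g (Z ∪ Y)  ≈⟨ +-cong (cond≈0⇒rank≈ Z|X≈0) (cond≈0⇒rank≈ Z|Y≈0) ⟩
      g X + g Y              ≈⟨ modular ⟩
      g (X ∪ Y) + g W        ∎))
    where
    open PosetReasoning poset
    X∪Y⊆Z∪X∪Z∪Y : X ∪ Y ⊆ (Z ∪ X) ∪ (Z ∪ Y)
    X∪Y⊆Z∪X∪Z∪Y = ∪-least (⊆-trans (q⊆p∪q Z X) (p⊆p∪q (Z ∪ Y)))
                          (⊆-trans (q⊆p∪q Z Y) (q⊆p∪q (Z ∪ X) (Z ∪ Y)))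
    Z∪W⊆Z∪X∩Z∪Y : Z ∪ W ⊆ (Z ∪ X) ∩ (Z ∪ Y)
    Z∪W⊆Z∪X∩Z∪Y = ∩-greatest (∪-least (p⊆p∪q X) (⊆-trans W⊆X (q⊆p∪q Z X)))
                             (∪-least (p⊆p∪q Y) (⊆-trans W⊆Y (q⊆p∪q Z Y)))

  same-info⇒rank≈ : ∀ {Z A W} → cond F g W Z ≈ cond F g W A → g (Z ∪ W) + g A ≈ g (W ∪ A) + g Z
  same-info⇒rank≈ {Z} {A} {W} W|Z≈W|A =
    ≈-trans (+-congʳ (≈-reflexive (cong g (∪-comm Z W)))) (-≈-⇒+≈+ W|Z≈W|A)

  -- The third hypothesis says that X and Y have the same mutual information with A.
  cond≈0-transfer : ∀ {Z A X Y} → cond F g X Z ≈ cond F g X A → cond F g Y Z ≈ cond F g Y A →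
                    g X + g (Y ∪ A) ≈ g Y + g (X ∪ A) →
                    cond F g Z X ≈ 0# → cond F g Z Y ≈ 0#
  cond≈0-transfer {Z} {A} {X} {Y} X|Z≈X|A Y|Z≈Y|A sameMutualInfo Z|X≈0 =
    x≈y⇒x-y≈0 (+-cancelʳ (g A + g (X ∪ A)) (g (Z ∪ Y)) (g Y) (begin
      g (Z ∪ Y) + (g A + g (X ∪ A))  ≈⟨ +-assoc (g (Z ∪ Y)) (g A) (g (X ∪ A)) ⟨
      g (Z ∪ Y) + g A + g (X ∪ A)    ≈⟨ +-congʳ (same-info⇒rank≈ Y|Z≈Y|A) ⟩
      g (Y ∪ A) + g Z + g (X ∪ A)    ≈⟨ xy∙z≈x∙zy (g (Y ∪ A)) (g Z) (g (X ∪ A)) ⟩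
      g (Y ∪ A) + (g (X ∪ A) + g Z)  ≈⟨ +-congˡ X∪A+Z≈X+A ⟩
      g (Y ∪ A) + (g X + g A)        ≈⟨ x∙yz≈yx∙z (g (Y ∪ A)) (g X) (g A) ⟩
      g X + g (Y ∪ A) + g A          ≈⟨ +-congʳ sameMutualInfo ⟩
      g Y + g (X ∪ A) + g A          ≈⟨ xy∙z≈x∙zy (g Y) (g (X ∪ A)) (g A) ⟩
      g Y + (g A + g (X ∪ A))        ∎))
    where
    open SetoidReasoning setoid
    X∪A+Z≈X+A : g (X ∪ A) + g Z ≈ g X + g A
    X∪A+Z≈X+A = ≈-trans (≈-sym (same-info⇒rank≈ X|Z≈X|A)) (+-congʳ (cond≈0⇒rank≈ Z|X≈0))

  cond≈0-each : ∀ {Z L₀ L₁ L₂} →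
    g (L₁ ∪ L₂) + g (L₁ ∪ L₀) ≈ g L₁ + g ((L₁ ∪ L₂) ∪ L₀) →
    g (L₁ ∪ L₂) + g (L₂ ∪ L₀) ≈ g L₂ + g ((L₁ ∪ L₂) ∪ L₀) →
    g (L₀ ∪ L₁) + g (L₀ ∪ L₂) ≈ g ((L₀ ∪ L₁) ∪ (L₀ ∪ L₂)) + g L₀ →
    cond F g Z (L₁ ∪ L₂) ≈ 0# →
    cond F g L₁ Z ≈ cond F g L₁ L₀ →
    cond F g L₂ Z ≈ cond F g L₂ L₀ →
    cond F g (L₁ ∪ L₂) Z ≈ cond F g (L₁ ∪ L₂) L₀ →
    cond F g Z L₀ ≈ 0# × cond F g Z L₁ ≈ 0# × cond F g Z L₂ ≈ 0#
  cond≈0-each {Z} {L₀} {L₁} {L₂} modular₁ modular₂ modular₀ Z|L₁₂≈0 info₁ info₂ info₁₂ =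
    Z|L₀≈0 , Z|L₁≈0 , Z|L₂≈0
    where
    Z|L₁≈0 : cond F g Z L₁ ≈ 0#
    Z|L₁≈0 = cond≈0-transfer info₁₂ info₁ modular₁ Z|L₁₂≈0
    Z|L₂≈0 : cond F g Z L₂ ≈ 0#
    Z|L₂≈0 = cond≈0-transfer info₁₂ info₂ modular₂ Z|L₁₂≈0
    Z|L₀≈0 : cond F g Z L₀ ≈ 0#
    Z|L₀≈0 = cond≈0-meet (p⊆p∪q L₁) (p⊆p∪q L₂) modular₀
      (cond≈0-mono (q⊆p∪q L₀ L₁) Z|L₁≈0) (cond≈0-mono (q⊆p∪q L₀ L₂) Z|L₂≈0)

proposition3p15 : ∀ {c ℓ₁ ℓ₂ : Level} (F : OrderedField c ℓ₁ ℓ₂) (n : ℕ)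
    (f : Subset n → OrderedField.Carrier F) → IsPolymatroid F n f →
    (L₀ L₁ L₂ : Subset n) →
    OrderedField._≈_ F (f L₀) (OrderedField.2# F) →
    OrderedField._≈_ F (f L₁) (OrderedField.2# F) →
    OrderedField._≈_ F (f L₂) (OrderedField.2# F) →
    OrderedField._≈_ F (f (L₀ ∪ L₁)) (OrderedField.3# F) →
    OrderedField._≈_ F (f (L₀ ∪ L₂)) (OrderedField.3# F) →
    OrderedField._≈_ F (f (L₁ ∪ L₂)) (OrderedField.3# F) →
    OrderedField._≈_ F (f (L₀ ∪ L₁ ∪ L₂)) (OrderedField.4# F) →
    (g : Subset (suc n) → OrderedField.Carrier F) →
    IsAKExtension F n f g (L₁ ∪ L₂) L₀ →
    OrderedField._≈_ F (cond F g (Zset F) (lift F L₀)) (OrderedField.0# F)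
    × OrderedField._≈_ F (cond F g (Zset F) (lift F L₁)) (OrderedField.0# F)
    × OrderedField._≈_ F (cond F g (Zset F) (lift F L₂)) (OrderedField.0# F)
proposition3p15 F n f _ L₀ L₁ L₂ r₀ r₁ r₂ r₀₁ r₀₂ r₁₂ r₀₁₂ g ak =
  cond≈0-each
    (+≈+-cong (rank r₁₂) (rank (swap r₀₁)) (rank r₁) (rank (swap r₀₁₂)) 3+3≈2+4)
    (+≈+-cong (rank r₁₂) (rank (swap r₀₂)) (rank r₂) (rank (swap r₀₁₂)) 3+3≈2+4)
    (+≈+-cong (rank r₀₁) (rank r₀₂) (rank r₀₁∪₀₂) (rank r₀) (≈-trans 3+3≈2+4 (+-comm 2# 4#)))
    determined
    (same-info L₁ (p⊆p∪q L₂)) (same-info L₂ (q⊆p∪q L₁ L₂)) (same-info (L₁ ∪ L₂) λ x∈ → x∈)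
  where
  open OrderedField F
  open OrderedFieldProperties F
  open IsAKExtension ak
  open IsOnePointExtension extension
  open PolymatroidProperties F polymatroid
  open IdempotentCommutativeMonoidProperties (∪-idempotentCommutativeMonoid n)
    using () renaming (∙-distrˡ-∙ to ∪-distribˡ-∪)

  rank : ∀ {X a} → f X ≈ a → g (lift F X) ≈ a
  rank {X} = ≈-trans (restricts X)

  swap : ∀ {A B a} → f (A ∪ B) ≈ a → f (B ∪ A) ≈ a
  swap {A} {B} = ≈-trans (≈-reflexive (cong f (∪-comm B A)))

  r₀₁∪₀₂ : f ((L₀ ∪ L₁) ∪ (L₀ ∪ L₂)) ≈ 4#
  r₀₁∪₀₂ = ≈-trans (≈-reflexive (cong f (sym (∪-distribˡ-∪ L₀ L₁ L₂)))) r₀₁₂
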